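{- Let $\mathbf{A}=\langle A,\vee,\wedge,\ast,\to,\forall,\exists,0,1\rangle$ be an Epistemic BL-algebra. Then for all $a,b\in A$: (E6) $\forall 0=0$; (E7) $\exists 1=1$; (E8) $\forall\forall a=\forall a$; (E9) $\exists\forall a=\forall a$; (E10) $\exists\exists a=\exists a$; (E11) $\forall\exists a=\exists a$; (E12) $\exists(\exists a\vee\exists b)=\exists a\vee\exists b$; (E13) $\exists(\exists a\ast\exists b)=\exists a\ast\exists b$; (E14) $\forall(\exists a\to b)=\exists a\to\forall b$; (E15) $\exists(\exists a\to\exists b)=\exists a\to\exists b$; (E16) $\exists(\exists a\wedge\exists b)=\exists a\wedge\exists b$; (E17) $\forall\neg a=\neg\exists a$; (E18) $\forall(\forall a\to a)=1$; (E19) $\forall(a\to\exists a)=1$; (M$\forall$) if $a\to b=1$ then $\forall a\to\forall b=1$; (M$\exists$) if $a\to b=1$ then $\exists a\to\exists b=1$.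
   Context: A BL-algebra is an algebra $\langle A,\wedge,\vee,\ast,\to,0,1\rangle$ such that $\langle A,\wedge,\vee,0,1\rangle$ is a bounded lattice (with order $\le$), $\langle A,\ast,1\rangle$ is a commutative monoid, $a\ast b\le c$ iff $a\le b\to c$ for all $a,b,c$, and the identities $a\wedge b=a\ast(a\to b)$ and $(a\to b)\vee(b\to a)=1$ hold. Put $\neg a:=a\to 0$. An Epistemic BL-algebra (EBL-algebra) is an algebra $\langle A,\vee,\wedge,\ast,\to,\forall,\exists,0,1\rangle$ whose reduct $\langle A,\vee,\wedge,\ast,\to,0,1\rangle$ is a BL-algebra and where $\forall,\exists$ are unary operations satisfying, for all $a,b$: (E$\forall$) $\forall 1=1$; (E$\exists$) $\exists 0=0$; (E1) $\forall a\to\exists a=1$; (E2) $\forall(a\to\forall b)=\exists a\to\forall b$; (E3) $\forall(\forall a\to b)=\forall a\to\forall b$; (E4) $\exists a\to\forall\exists a=1$; (E4a) $\forall(a\wedge b)=\forall a\wedge\forall b$; (E4b) $\exists(a\vee b)=\exists a\vee\exists b$; (E5) $\exists(a\ast\exists b)=\exists a\ast\exists b$. -}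

module Defs where

open import Level using (Level; suc)
open import Data.Product using (_×_)
open import Relation.Binary.PropositionalEquality using (_≡_)

record BLAlgebra (ℓ : Level) : Set (suc ℓ) where
  infixr 6 _∨_
  infixr 7 _∧_
  infixr 7 _*_
  infixr 5 _⇒_
  field
    Carrier : Set ℓ
    _∨_ _∧_ _*_ _⇒_ : Carrier → Carrier → Carrier
    𝟘 𝟙 : Carrier
    ∨-comm   : ∀ a b → a ∨ b ≡ b ∨ a
    ∧-comm   : ∀ a b → a ∧ b ≡ b ∧ a
    ∨-assoc  : ∀ a b c → (a ∨ b) ∨ c ≡ a ∨ (b ∨ c)
    ∧-assoc  : ∀ a b c → (a ∧ b) ∧ c ≡ a ∧ (b ∧ c)
    ∨-absorb : ∀ a b → a ∨ (a ∧ b) ≡ a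
    ∧-absorb : ∀ a b → a ∧ (a ∨ b) ≡ a
    𝟘-bot    : ∀ a → 𝟘 ∧ a ≡ 𝟘
    𝟙-top    : ∀ a → a ∧ 𝟙 ≡ a
    *-comm   : ∀ a b → a * b ≡ b * a
    *-assoc  : ∀ a b c → (a * b) * c ≡ a * (b * c)
    *-identʳ : ∀ a → a * 𝟙 ≡ a
  _≤_ : Carrier → Carrier → Set ℓ
  a ≤ b = a ∧ b ≡ a
  field
    residₗ   : ∀ a b c → (a * b) ≤ c → a ≤ (b ⇒ c)
    residᵣ   : ∀ a b c → a ≤ (b ⇒ c) → (a * b) ≤ c
    divis    : ∀ a b → a ∧ b ≡ a * (a ⇒ b)
    prelin   : ∀ a b → (a ⇒ b) ∨ (b ⇒ a) ≡ 𝟙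
  ¬_ : Carrier → Carrier
  ¬ a = a ⇒ 𝟘

record EBLAlgebra (ℓ : Level) : Set (suc ℓ) where
  field
    bl : BLAlgebra ℓ
  open BLAlgebra bl public
  field
    ∀′ ∃′ : Carrier → Carrier
    E∀   : ∀′ 𝟙 ≡ 𝟙
    E∃   : ∃′ 𝟘 ≡ 𝟘
    E1   : ∀ a → (∀′ a ⇒ ∃′ a) ≡ 𝟙
    E2   : ∀ a b → ∀′ (a ⇒ ∀′ b) ≡ (∃′ a ⇒ ∀′ b)
    E3   : ∀ a b → ∀′ (∀′ a ⇒ b) ≡ (∀′ a ⇒ ∀′ b)
    E4   : ∀ a → (∃′ a ⇒ ∀′ (∃′ a)) ≡ 𝟙
    E4a  : ∀ a b → ∀′ (a ∧ b) ≡ ∀′ a ∧ ∀′ b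
    E4b  : ∀ a b → ∃′ (a ∨ b) ≡ ∃′ a ∨ ∃′ b
    E5   : ∀ a b → ∃′ (a * ∃′ b) ≡ ∃′ a * ∃′ b

EBL-consequences : ∀ {ℓ} → EBLAlgebra ℓ → Set ℓ
EBL-consequences A =
    (∀′ 𝟘 ≡ 𝟘)
  × (∃′ 𝟙 ≡ 𝟙)
  × (∀ a → ∀′ (∀′ a) ≡ ∀′ a)
  × (∀ a → ∃′ (∀′ a) ≡ ∀′ a)
  × (∀ a → ∃′ (∃′ a) ≡ ∃′ a)
  × (∀ a → ∀′ (∃′ a) ≡ ∃′ a)
  × (∀ a b → ∃′ (∃′ a ∨ ∃′ b) ≡ ∃′ a ∨ ∃′ b)
  × (∀ a b → ∃′ (∃′ a * ∃′ b) ≡ ∃′ a * ∃′ b)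
  × (∀ a b → ∀′ (∃′ a ⇒ b) ≡ (∃′ a ⇒ ∀′ b))
  × (∀ a b → ∃′ (∃′ a ⇒ ∃′ b) ≡ (∃′ a ⇒ ∃′ b))
  × (∀ a b → ∃′ (∃′ a ∧ ∃′ b) ≡ ∃′ a ∧ ∃′ b)
  × (∀ a → ∀′ (¬ a) ≡ ¬ (∃′ a))
  × (∀ a → ∀′ (∀′ a ⇒ a) ≡ 𝟙)
  × (∀ a → ∀′ (a ⇒ ∃′ a) ≡ 𝟙)
  × (∀ a b → (a ⇒ b) ≡ 𝟙 → (∀′ a ⇒ ∀′ b) ≡ 𝟙)
  × (∀ a b → (a ⇒ b) ≡ 𝟙 → (∃′ a ⇒ ∃′ b) ≡ 𝟙)
  where open EBLAlgebra A

module Submission where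

open import Defs
open import Level using (Level)
open import Data.Product using (_,_)
open import Relation.Binary.PropositionalEquality using (_≡_; sym; trans; cong; cong₂; subst; module ≡-Reasoning)

-- ∀ and ∃ have the same fixed points. With a ⇒ a = 1, E3 gives ∀ a ≤ ∀ ∀ a and E2 gives
-- ∃ ∀ a ≤ ∀ a, so ∀ ∀ a ≤ ∃ ∀ a ≤ ∀ a ≤ ∀ ∀ a by E1: every ∀ a is fixed by both operators.
-- E5 with a = 1 and E4 do the same for every ∃ a. The common fixed points are closed under
-- ∨, ∧, ∗ and ⇒ (by E4b, E4a, E5 and E2/E3), and E6–E19 are instances of these closure facts.

module BLProperties {ℓ : Level} (B : BLAlgebra ℓ) where
  open BLAlgebra B
  open ≡-Reasoning

  ≤-refl : ∀ a → a ≤ a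
  ≤-refl a = begin
    a ∧ a           ≡⟨ cong (a ∧_) (sym (∨-absorb a a)) ⟩
    a ∧ (a ∨ a ∧ a) ≡⟨ ∧-absorb a (a ∧ a) ⟩
    a               ∎

  ≤-trans : ∀ {a b c} → a ≤ b → b ≤ c → a ≤ c
  ≤-trans {a} {b} {c} a≤b b≤c = begin
    a ∧ c       ≡⟨ cong (_∧ c) (sym a≤b) ⟩
    (a ∧ b) ∧ c ≡⟨ ∧-assoc a b c ⟩
    a ∧ (b ∧ c) ≡⟨ cong (a ∧_) b≤c ⟩
    a ∧ b       ≡⟨ a≤b ⟩
    a           ∎

  ≤-antisym : ∀ {a b} → a ≤ b → b ≤ a → a ≡ b
  ≤-antisym {a} {b} a≤b b≤a = trans (sym a≤b) (trans (∧-comm a b) b≤a)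

  𝟙≤⇒≡𝟙 : ∀ {a} → 𝟙 ≤ a → a ≡ 𝟙
  𝟙≤⇒≡𝟙 {a} 𝟙≤a = ≤-antisym (𝟙-top a) 𝟙≤a

  ≤⇒∨≡ : ∀ {a b} → a ≤ b → a ∨ b ≡ b
  ≤⇒∨≡ {a} {b} a≤b = begin
    a ∨ b       ≡⟨ cong (_∨ b) (sym a≤b) ⟩
    a ∧ b ∨ b   ≡⟨ ∨-comm (a ∧ b) b ⟩
    b ∨ a ∧ b   ≡⟨ cong (b ∨_) (∧-comm a b) ⟩
    b ∨ b ∧ a   ≡⟨ ∨-absorb b a ⟩
    b           ∎

  *-identityˡ : ∀ a → 𝟙 * a ≡ a
  *-identityˡ a = trans (*-comm 𝟙 a) (*-identʳ a)

  ≤⇒⇒≡𝟙 : ∀ {a b} → a ≤ b → (a ⇒ b) ≡ 𝟙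
  ≤⇒⇒≡𝟙 {a} {b} a≤b =
    𝟙≤⇒≡𝟙 (residₗ 𝟙 a b (subst (_≤ b) (sym (*-identityˡ a)) a≤b))

  ⇒≡𝟙⇒≤ : ∀ {a b} → (a ⇒ b) ≡ 𝟙 → a ≤ b
  ⇒≡𝟙⇒≤ {a} {b} a⇒b≡𝟙 =
    subst (_≤ b) (*-identityˡ a) (residᵣ 𝟙 a b (subst (𝟙 ≤_) (sym a⇒b≡𝟙) (≤-refl 𝟙)))

  ⇒-refl : ∀ a → (a ⇒ a) ≡ 𝟙
  ⇒-refl a = ≤⇒⇒≡𝟙 (≤-refl a)

module EBLProperties {ℓ : Level} (A : EBLAlgebra ℓ) where
  open EBLAlgebra A
  open BLProperties bl
  open ≡-Reasoning

  ∀-mono : ∀ {a b} → a ≤ b → ∀′ a ≤ ∀′ b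
  ∀-mono {a} {b} a≤b = trans (sym (E4a a b)) (cong ∀′ a≤b)

  ∃-mono : ∀ {a b} → a ≤ b → ∃′ a ≤ ∃′ b
  ∃-mono {a} {b} a≤b =
    subst (∃′ a ≤_) (trans (sym (E4b a b)) (cong ∃′ (≤⇒∨≡ a≤b))) (∧-absorb (∃′ a) (∃′ b))

  ∀≤∃ : ∀ a → ∀′ a ≤ ∃′ a
  ∀≤∃ a = ⇒≡𝟙⇒≤ (E1 a)

  ∀≤∀∀ : ∀ a → ∀′ a ≤ ∀′ (∀′ a)
  ∀≤∀∀ a = ⇒≡𝟙⇒≤ (begin
    (∀′ a ⇒ ∀′ (∀′ a)) ≡⟨ sym (E3 a (∀′ a)) ⟩
    ∀′ (∀′ a ⇒ ∀′ a)   ≡⟨ cong ∀′ (⇒-refl (∀′ a)) ⟩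
    ∀′ 𝟙               ≡⟨ E∀ ⟩
    𝟙                  ∎)

  ∃∀≤∀ : ∀ a → ∃′ (∀′ a) ≤ ∀′ a
  ∃∀≤∀ a = ⇒≡𝟙⇒≤ (begin
    (∃′ (∀′ a) ⇒ ∀′ a) ≡⟨ sym (E2 (∀′ a) a) ⟩
    ∀′ (∀′ a ⇒ ∀′ a)   ≡⟨ cong ∀′ (⇒-refl (∀′ a)) ⟩
    ∀′ 𝟙               ≡⟨ E∀ ⟩
    𝟙                  ∎)

  ∀𝟘≡𝟘 : ∀′ 𝟘 ≡ 𝟘
  ∀𝟘≡𝟘 = ≤-antisym (subst (∀′ 𝟘 ≤_) E∃ (∀≤∃ 𝟘)) (𝟘-bot (∀′ 𝟘))

  ∃𝟙≡𝟙 : ∃′ 𝟙 ≡ 𝟙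
  ∃𝟙≡𝟙 = ≤-antisym (𝟙-top (∃′ 𝟙)) (subst (_≤ ∃′ 𝟙) E∀ (∀≤∃ 𝟙))

  ∀-idem : ∀ a → ∀′ (∀′ a) ≡ ∀′ a
  ∀-idem a = ≤-antisym (≤-trans (∀≤∃ (∀′ a)) (∃∀≤∀ a)) (∀≤∀∀ a)

  ∃∀≡∀ : ∀ a → ∃′ (∀′ a) ≡ ∀′ a
  ∃∀≡∀ a = ≤-antisym (∃∀≤∀ a) (subst (_≤ ∃′ (∀′ a)) (∀-idem a) (∀≤∃ (∀′ a)))

  ∃-idem : ∀ a → ∃′ (∃′ a) ≡ ∃′ a
  ∃-idem a = begin
    ∃′ (∃′ a)     ≡⟨ cong ∃′ (sym (*-identityˡ (∃′ a))) ⟩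
    ∃′ (𝟙 * ∃′ a) ≡⟨ E5 𝟙 a ⟩
    ∃′ 𝟙 * ∃′ a   ≡⟨ cong (_* ∃′ a) ∃𝟙≡𝟙 ⟩
    𝟙 * ∃′ a      ≡⟨ *-identityˡ (∃′ a) ⟩
    ∃′ a          ∎

  ∀∃≡∃ : ∀ a → ∀′ (∃′ a) ≡ ∃′ a
  ∀∃≡∃ a = ≤-antisym (subst (∀′ (∃′ a) ≤_) (∃-idem a) (∀≤∃ (∃′ a))) (⇒≡𝟙⇒≤ (E4 a))

  ∀-closed⇒∃-closed : ∀ {c} → ∀′ c ≡ c → ∃′ c ≡ c
  ∀-closed⇒∃-closed {c} ∀c≡c = begin
    ∃′ c      ≡⟨ cong ∃′ (sym ∀c≡c) ⟩
    ∃′ (∀′ c) ≡⟨ ∃∀≡∀ c ⟩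
    ∀′ c      ≡⟨ ∀c≡c ⟩
    c         ∎

  ∀-⇒-closedʳ : ∀ a {c} → ∀′ c ≡ c → ∀′ (a ⇒ c) ≡ (∃′ a ⇒ c)
  ∀-⇒-closedʳ a {c} ∀c≡c = begin
    ∀′ (a ⇒ c)    ≡⟨ cong (λ z → ∀′ (a ⇒ z)) (sym ∀c≡c) ⟩
    ∀′ (a ⇒ ∀′ c) ≡⟨ E2 a c ⟩
    (∃′ a ⇒ ∀′ c) ≡⟨ cong (∃′ a ⇒_) ∀c≡c ⟩
    (∃′ a ⇒ c)    ∎

  ∀-⇒-closedˡ : ∀ {c} b → ∀′ c ≡ c → ∀′ (c ⇒ b) ≡ (c ⇒ ∀′ b)
  ∀-⇒-closedˡ {c} b ∀c≡c = begin
    ∀′ (c ⇒ b)    ≡⟨ cong (λ z → ∀′ (z ⇒ b)) (sym ∀c≡c) ⟩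
    ∀′ (∀′ c ⇒ b) ≡⟨ E3 c b ⟩
    (∀′ c ⇒ ∀′ b) ≡⟨ cong (_⇒ ∀′ b) ∀c≡c ⟩
    (c ⇒ ∀′ b)    ∎

  ∀-closed-⇒ : ∀ {c d} → ∀′ c ≡ c → ∀′ d ≡ d → ∀′ (c ⇒ d) ≡ (c ⇒ d)
  ∀-closed-⇒ {c} {d} ∀c≡c ∀d≡d = trans (∀-⇒-closedˡ d ∀c≡c) (cong (c ⇒_) ∀d≡d)

  ∀-closed-∧ : ∀ {c d} → ∀′ c ≡ c → ∀′ d ≡ d → ∀′ (c ∧ d) ≡ c ∧ d
  ∀-closed-∧ {c} {d} ∀c≡c ∀d≡d = trans (E4a c d) (cong₂ _∧_ ∀c≡c ∀d≡d)

  ∃-closed-∨ : ∀ {c d} → ∃′ c ≡ c → ∃′ d ≡ d → ∃′ (c ∨ d) ≡ c ∨ d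
  ∃-closed-∨ {c} {d} ∃c≡c ∃d≡d = trans (E4b c d) (cong₂ _∨_ ∃c≡c ∃d≡d)

  ∃-closed-* : ∀ {c d} → ∃′ c ≡ c → ∃′ d ≡ d → ∃′ (c * d) ≡ c * d
  ∃-closed-* {c} {d} ∃c≡c ∃d≡d = begin
    ∃′ (c * d)    ≡⟨ cong (λ z → ∃′ (c * z)) (sym ∃d≡d) ⟩
    ∃′ (c * ∃′ d) ≡⟨ E5 c d ⟩
    ∃′ c * ∃′ d   ≡⟨ cong₂ _*_ ∃c≡c ∃d≡d ⟩
    c * d         ∎

  ∀-mono-⇒ : ∀ a b → (a ⇒ b) ≡ 𝟙 → (∀′ a ⇒ ∀′ b) ≡ 𝟙
  ∀-mono-⇒ a b a⇒b≡𝟙 = ≤⇒⇒≡𝟙 (∀-mono (⇒≡𝟙⇒≤ a⇒b≡𝟙))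

  ∃-mono-⇒ : ∀ a b → (a ⇒ b) ≡ 𝟙 → (∃′ a ⇒ ∃′ b) ≡ 𝟙
  ∃-mono-⇒ a b a⇒b≡𝟙 = ≤⇒⇒≡𝟙 (∃-mono (⇒≡𝟙⇒≤ a⇒b≡𝟙))

lemma1 : ∀ {ℓ : Level} (A : EBLAlgebra ℓ) → EBL-consequences A
lemma1 A =
    ∀𝟘≡𝟘
  , ∃𝟙≡𝟙
  , ∀-idem
  , ∃∀≡∀
  , ∃-idem
  , ∀∃≡∃
  , (λ a b → ∃-closed-∨ (∃-idem a) (∃-idem b))
  , (λ a b → ∃-closed-* (∃-idem a) (∃-idem b))
  , (λ a b → ∀-⇒-closedˡ b (∀∃≡∃ a))
  , (λ a b → ∀-closed⇒∃-closed (∀-closed-⇒ (∀∃≡∃ a) (∀∃≡∃ b)))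
  , (λ a b → ∀-closed⇒∃-closed (∀-closed-∧ (∀∃≡∃ a) (∀∃≡∃ b)))
  , (λ a → ∀-⇒-closedʳ a ∀𝟘≡𝟘)
  , (λ a → trans (∀-⇒-closedˡ a (∀-idem a)) (⇒-refl (∀′ a)))
  , (λ a → trans (∀-⇒-closedʳ a (∀∃≡∃ a)) (⇒-refl (∃′ a)))
  , ∀-mono-⇒
  , ∃-mono-⇒
  where
    open EBLAlgebra A
    open BLProperties bl
    open EBLProperties A
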